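{- Let $d\ge1$ and let $k>2$ be an even integer. Suppose $S_1,\dots,S_k$ are $k$ distinct even-size subsets of $\{1,\dots,d\}$ such that $|S_\alpha\triangle S_\beta|\ge4$ for all $\alpha\ne\beta$, and such that for every four distinct indices $\alpha,\beta,\gamma,\delta$ the tetrahedral intersection number $$t_{\alpha\beta\gamma\delta}=\dim\big(M_\alpha\cap M_\beta\cap M_\gamma\cap M_\delta\big)=\#\{i\in\{1,\dots,d\}: i\in S_\alpha\cap S_\beta\cap S_\gamma\cap S_\delta\ \text{or}\ i\notin S_\alpha\cup S_\beta\cup S_\gamma\cup S_\delta\}$$ satisfies $t_{\alpha\beta\gamma\delta}\le d-7$. Then $$k^2(28-3d)-k(112-6d)+12d+84\ \le\ 0 .$$ In particular, for $d=7$ one must have $k\le 6$, and for $d=8$ one must have $k\le 12$.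
   Context: Setting: $\mathbb{C}^{2d}$ with a nondegenerate symmetric bilinear form and a canonical null basis $a_1,\dots,a_d,a_1^\dagger,\dots,a_d^\dagger$ ($g(a_i,a_j)=g(a_i^\dagger,a_j^\dagger)=0$, $g(a_i,a_j^\dagger)=\delta_{ij}$). For an even-size subset $S\subseteq\{1,\dots,d\}$, the basis pure semi-spinor $\psi_S=\prod_{i\in S}a_i^\dagger\psi_0$ (where $\psi_0$ is annihilated by all $a_i$) has null subspace $M_S=M(\psi_S)=\mathrm{Span}(\{a_i:i\notin S\}\cup\{a_i^\dagger:i\in S\})$; here $M_\alpha$ denotes $M(\psi_{S_\alpha})$. Pairwise, $\dim(M_S\cap M_T)=d-|S\triangle T|$. -}

module Defs where

open import Data.Nat using (ℕ)
open import Data.Fin using (Fin)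
open import Data.Fin.Subset using (Subset; _∩_; _∪_; _─_; ∁; ∣_∣)

_△_ : ∀ {d} → Subset d → Subset d → Subset d
S △ T = (S ─ T) ∪ (T ─ S)

tetra : ∀ {d} → Subset d → Subset d → Subset d → Subset d → ℕ
tetra A B C D = ∣ (A ∩ B ∩ C ∩ D) ∪ ∁ (A ∪ B ∪ C ∪ D) ∣

{-# OPTIONS --safe #-}
module Submission where

open import Defs
open import Data.Nat using (ℕ; _≤_; _<_; _+_)
open import Data.Nat.Divisibility using (_∣_)
open import Data.Fin using (Fin)
open import Data.Fin.Subset using (Subset; ∣_∣)
open import Data.Integer using (ℤ; +_) renaming (_+_ to _+ℤ_; _*_ to _*ℤ_; _-_ to _-ℤ_; _≤_ to _≤ℤ_)
open import Data.Product using (_×_)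
open import Relation.Binary.PropositionalEquality using (_≡_; _≢_)
open import Function.Definitions using (Injective)

open import Data.Bool using (Bool; true; false)
open import Data.Bool.Properties using (¬-not)
open import Data.Empty using (⊥-elim)
open import Data.Fin using (toℕ; fromℕ<)
open import Data.Fin.Properties using (all?; toℕ-fromℕ<)
open import Data.Integer using (0ℤ; -_; +≤+) renaming (_≤?_ to _≤ℤ?_)
import Data.Integer.Properties as ℤ
open import Data.Integer.Tactic.RingSolver using (solve-∀)
open import Data.List using (List; []; _∷_; length; filter)
open import Data.List.Properties using (length-tabulate)
open import Data.List.Membership.Propositional using (_∈_)
open import Data.List.Membership.Propositional.Properties using (∈-filter⁻)
open import Data.List.Relation.Unary.All using (All; []; _∷_)
import Data.List.Relation.Unary.All as All
open import Data.List.Relation.Unary.AllPairs using ([]; _∷_)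
open import Data.List.Relation.Unary.Any using (here; there)
open import Data.List.Relation.Unary.Unique.Propositional using (Unique)
open import Data.List.Relation.Unary.Unique.Propositional.Properties using (allFin⁺; filter⁺)
open import Data.Nat using (suc; _*_; _^_; z≤n; s≤s; _<?_)
open import Data.Nat.Divisibility using (_∣?_)
import Data.Nat.Properties as ℕ
import Data.Nat.Tactic.RingSolver as NS
import Data.Bool as Bool
open import Data.Product using (Σ-syntax; _,_; proj₁; proj₂)
open import Data.Sum using (_⊎_; inj₁; inj₂; [_,_]′)
open import Data.Vec using (Vec; _∷_; head; tail)
open import Function using (_∘_)
open import Relation.Binary.PropositionalEquality using (refl; sym; trans; cong; subst; subst₂)
open import Relation.Nullary using (¬_; yes; no; does; contradiction)
open import Relation.Nullary.Decidable using (True; toWitness; from-no)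
open import Relation.Unary using (Pred; Decidable)
open import Relation.Unary.Properties using (∁?)

-- Four vectors sharing their first c entries have tetrahedral number at least c.
-- Splitting a family on its first coordinate keeps at least half of it, so more
-- than 3·2ᶜ vectors always contain four that agree on the first c coordinates.
-- Since every such quadruple has tetrahedral number at most d − 7, the family has
-- at most 3·2^(d−6) members (and d ≥ 7, as k ≥ 4). For d = 7, 8, 9 this bounds k
-- by 6, 12, 24, a range on which the quadratic is nonpositive; for d ≥ 10 the
-- quadratic is negative for every k ≥ 4.

tetra-shared-head : ∀ {m} b (A B C D : Vec Bool (suc m))
  → head A ≡ b → head B ≡ b → head C ≡ b → head D ≡ b
  → tetra A B C D ≡ suc (tetra (tail A) (tail B) (tail C) (tail D))
tetra-shared-head true  (_ ∷ _) (_ ∷ _) (_ ∷ _) (_ ∷ _) refl refl refl refl = refl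
tetra-shared-head false (_ ∷ _) (_ ∷ _) (_ ∷ _) (_ ∷ _) refl refl refl refl = refl

record Quadruple (A : Set) : Set where
  constructor quadruple
  field
    α β γ δ : A
    α≢β : α ≢ β
    α≢γ : α ≢ γ
    α≢δ : α ≢ δ
    β≢γ : β ≢ γ
    β≢δ : β ≢ δ
    γ≢δ : γ ≢ δ

  members : List A
  members = α ∷ β ∷ γ ∷ δ ∷ []

open Quadruple using (members)

tetraOf : ∀ {A : Set} {m} → (A → Vec Bool m) → Quadruple A → ℕ
tetraOf V q = tetra (V α) (V β) (V γ) (V δ) where open Quadruple q

length-filter+length-filter-∁ : ∀ {p} {A : Set} {P : Pred A p} (P? : Decidable P) xs
  → length (filter P? xs) + length (filter (∁? P?) xs) ≡ length xs
length-filter+length-filter-∁ P? [] = refl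
length-filter+length-filter-∁ P? (x ∷ xs) with does (P? x)
... | true  = cong suc (length-filter+length-filter-∁ P? xs)
... | false = trans (ℕ.+-suc _ _) (cong suc (length-filter+length-filter-∁ P? xs))

<-half-of-sum : ∀ {m a b} → m + m < a + b → m < a ⊎ m < b
<-half-of-sum {m} {a} {b} m+m<a+b with m <? a | m <? b
... | yes m<a | _       = inj₁ m<a
... | no  _   | yes m<b = inj₂ m<b
... | no  m≮a | no  m≮b = contradiction (ℕ.+-mono-≤ (ℕ.≮⇒≥ m≮a) (ℕ.≮⇒≥ m≮b)) (ℕ.<⇒≱ m+m<a+b)

3*[2*x]≡3*x+3*x : ∀ x → 3 * (2 * x) ≡ 3 * x + 3 * x
3*[2*x]≡3*x+3*x = NS.solve-∀

tetra-pigeonhole : ∀ {A : Set} c {n} (V : A → Vec Bool (c + n)) {L : List A} → Unique L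
  → 3 * 2 ^ c < length L
  → Σ[ q ∈ Quadruple A ] All (_∈ L) (members q) × c ≤ tetraOf V q
tetra-pigeonhole 0 V {α ∷ β ∷ γ ∷ δ ∷ _}
  ((α≢β ∷ α≢γ ∷ α≢δ ∷ _) ∷ (β≢γ ∷ β≢δ ∷ _) ∷ (γ≢δ ∷ _) ∷ _) _ =
  quadruple α β γ δ α≢β α≢γ α≢δ β≢γ β≢δ γ≢δ
  , here refl ∷ there (here refl) ∷ there (there (here refl)) ∷ there (there (there (here refl))) ∷ []
  , z≤n
tetra-pigeonhole 0 V {[]} _ ()
tetra-pigeonhole 0 V {_ ∷ []} _ (s≤s ())
tetra-pigeonhole 0 V {_ ∷ _ ∷ []} _ (s≤s (s≤s ()))
tetra-pigeonhole 0 V {_ ∷ _ ∷ _ ∷ []} _ (s≤s (s≤s (s≤s ())))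
tetra-pigeonhole {A} (suc c) V {L} unique bound =
  [ onHalf true (filter startsTrue? L) (filter⁺ startsTrue? unique) (∈-filter⁻ startsTrue?)
  , onHalf false (filter (∁? startsTrue?) L) (filter⁺ (∁? startsTrue?) unique)
      (λ x∈H → let (x∈L , ¬true) = ∈-filter⁻ (∁? startsTrue?) x∈H in x∈L , ¬-not ¬true)
  ]′ (<-half-of-sum halves-exceed)
  where
  startsTrue? : Decidable (λ x → head (V x) ≡ true)
  startsTrue? x = head (V x) Bool.≟ true

  halves-exceed : 3 * 2 ^ c + 3 * 2 ^ c < length (filter startsTrue? L) + length (filter (∁? startsTrue?) L)
  halves-exceed = subst₂ _<_ (3*[2*x]≡3*x+3*x (2 ^ c)) (sym (length-filter+length-filter-∁ startsTrue? L)) bound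

  onHalf : ∀ b H → Unique H → (∀ {x} → x ∈ H → x ∈ L × head (V x) ≡ b)
    → 3 * 2 ^ c < length H
    → Σ[ q ∈ Quadruple A ] All (_∈ L) (members q) × suc c ≤ tetraOf V q
  onHalf b H uniqueH sel largeH with tetra-pigeonhole c (tail ∘ V) uniqueH largeH
  ... | q , q⊆H , c≤t with All.map (proj₂ ∘ sel) q⊆H
  ...   | hα ∷ hβ ∷ hγ ∷ hδ ∷ [] =
    q , All.map (proj₁ ∘ sel) q⊆H
      , subst (suc c ≤_) (sym (tetra-shared-head b (V α) (V β) (V γ) (V δ) hα hβ hγ hδ)) (s≤s c≤t)
    where open Quadruple q

family-size-bound : ∀ c n → n ≤ 6 → ∀ {k} (V : Fin k → Vec Bool (c + n))
  → (∀ q → tetraOf V q + 7 ≤ c + n)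
  → k ≤ 3 * 2 ^ c
family-size-bound c n n≤6 {k} V bounded = ℕ.≮⇒≥ no-large-family
  where
  no-large-family : ¬ (3 * 2 ^ c < k)
  no-large-family 3*2^c<k
    with tetra-pigeonhole c V (allFin⁺ k) (subst (_ <_) (sym (length-tabulate (λ i → i))) 3*2^c<k)
  ... | q , _ , c≤t = ℕ.<-irrefl refl (ℕ.+-cancelˡ-≤ c 7 6 (begin
    c + 7            ≤⟨ ℕ.+-monoˡ-≤ 7 c≤t ⟩
    tetraOf V q + 7  ≤⟨ bounded q ⟩
    c + n            ≤⟨ ℕ.+-monoʳ-≤ c n≤6 ⟩
    c + 6            ∎))
    where open ℕ.≤-Reasoning

quadratic : ℕ → ℕ → ℤ
quadratic d k = (+ k) *ℤ (+ k) *ℤ ((+ 28) -ℤ (+ 3) *ℤ (+ d)) -ℤ (+ k) *ℤ ((+ 112) -ℤ (+ 6) *ℤ (+ d)) +ℤ (+ 12) *ℤ (+ d) +ℤ (+ 84)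

quadratic-nonPos-between : ∀ d m
  → {True (all? λ (j : Fin (suc m)) → quadratic d (4 + toℕ j) ≤ℤ? 0ℤ)}
  → ∀ {k} → 4 ≤ k → k ≤ 4 + m → quadratic d k ≤ℤ 0ℤ
quadratic-nonPos-between d m {checked} 4≤k k≤4+m with ℕ.m≤n⇒∃[o]m+o≡n 4≤k
... | j , refl = subst (λ i → quadratic d (4 + i) ≤ℤ 0ℤ) (toℕ-fromℕ< j<1+m)
                   (toWitness checked (fromℕ< j<1+m))
  where
  j<1+m : j < suc m
  j<1+m = s≤s (ℕ.+-cancelˡ-≤ 4 j m k≤4+m)

quadratic[10+e,4+f] : ∀ (E F : ℤ) → let D = + 10 +ℤ E ; K = + 4 +ℤ F in
  K *ℤ K *ℤ ((+ 28) -ℤ (+ 3) *ℤ D) -ℤ K *ℤ ((+ 112) -ℤ (+ 6) *ℤ D) +ℤ (+ 12) *ℤ D +ℤ (+ 84)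
  ≡ - (+ 36 +ℤ + 68 *ℤ F +ℤ + 2 *ℤ (F *ℤ F) +ℤ E *ℤ (+ 12 +ℤ + 18 *ℤ F +ℤ + 3 *ℤ (F *ℤ F)))
quadratic[10+e,4+f] = solve-∀

0≤i*j : ∀ {i j} → 0ℤ ≤ℤ i → 0ℤ ≤ℤ j → 0ℤ ≤ℤ i *ℤ j
0≤i*j {+ m} {+ n} _ _ = subst (0ℤ ≤ℤ_) (ℤ.pos-* m n) (+≤+ z≤n)

quadratic-nonPos-large : ∀ e {k} → 4 ≤ k → quadratic (10 + e) k ≤ℤ 0ℤ
quadratic-nonPos-large e 4≤k with ℕ.m≤n⇒∃[o]m+o≡n 4≤k
... | f , refl = subst (_≤ℤ 0ℤ) (sym (quadratic[10+e,4+f] (+ e) (+ f))) (ℤ.neg-mono-≤ 0≤P)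
  where
  0≤+ : ∀ n → 0ℤ ≤ℤ + n
  0≤+ n = +≤+ z≤n
  0≤P : 0ℤ ≤ℤ + 36 +ℤ + 68 *ℤ + f +ℤ + 2 *ℤ (+ f *ℤ + f) +ℤ + e *ℤ (+ 12 +ℤ + 18 *ℤ + f +ℤ + 3 *ℤ (+ f *ℤ + f))
  0≤P = ℤ.+-mono-≤ (ℤ.+-mono-≤ (ℤ.+-mono-≤ (0≤+ 36) (0≤i*j (0≤+ 68) (0≤+ f))) (0≤i*j (0≤+ 2) f²≥0))
          (0≤i*j (0≤+ e) (ℤ.+-mono-≤ (ℤ.+-mono-≤ (0≤+ 12) (0≤i*j (0≤+ 18) (0≤+ f))) (0≤i*j (0≤+ 3) f²≥0)))
    where
    f²≥0 : 0ℤ ≤ℤ + f *ℤ + f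
    f²≥0 = 0≤i*j (0≤+ f) (0≤+ f)

even>2⇒≥4 : ∀ {k} → 2 < k → 2 ∣ k → 4 ≤ k
even>2⇒≥4 2<k 2∣k = ℕ.≤∧≢⇒< 2<k λ { refl → from-no (2 ∣? 3) 2∣k }

bounds-from-tetra : ∀ d {k} → 4 ≤ k → (S : Fin k → Vec Bool d)
  → (∀ q → tetraOf S q + 7 ≤ d)
  → (quadratic d k ≤ℤ 0ℤ) × (d ≡ 7 → k ≤ 6) × (d ≡ 8 → k ≤ 12)
bounds-from-tetra d {k} 4≤k S bounded with d ℕ.≤? 6
... | yes d≤6 = ⊥-elim (ℕ.<⇒≱ 4≤k (family-size-bound 0 d d≤6 S bounded))
... | no  d≰6 with ℕ.m≤n⇒∃[o]m+o≡n (ℕ.≰⇒> d≰6)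
...   | 0 , refl = quadratic-nonPos-between 7 2 4≤k k≤6 , (λ _ → k≤6) , (λ ())
  where
  k≤6 : k ≤ 6
  k≤6 = family-size-bound 1 6 ℕ.≤-refl S bounded
...   | 1 , refl = quadratic-nonPos-between 8 8 4≤k k≤12 , (λ ()) , (λ _ → k≤12)
  where
  k≤12 : k ≤ 12
  k≤12 = family-size-bound 2 6 ℕ.≤-refl S bounded
...   | 2 , refl = quadratic-nonPos-between 9 20 4≤k (family-size-bound 3 6 ℕ.≤-refl S bounded)
                 , (λ ()) , (λ ())
...   | suc (suc (suc e)) , refl = quadratic-nonPos-large e 4≤k , (λ ()) , (λ ())

mainTheorem4 : (d k : ℕ) → 1 ≤ d → 2 < k → 2 ∣ k
    → (S : Fin k → Subset d)
    → Injective _≡_ _≡_ S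
    → (∀ α → 2 ∣ ∣ S α ∣)
    → (∀ α β → α ≢ β → 4 ≤ ∣ S α △ S β ∣)
    → (∀ α β γ δ → α ≢ β → α ≢ γ → α ≢ δ → β ≢ γ → β ≢ δ → γ ≢ δ
        → tetra (S α) (S β) (S γ) (S δ) + 7 ≤ d)
    → ((+ k) *ℤ (+ k) *ℤ ((+ 28) -ℤ (+ 3) *ℤ (+ d)) -ℤ (+ k) *ℤ ((+ 112) -ℤ (+ 6) *ℤ (+ d)) +ℤ (+ 12) *ℤ (+ d) +ℤ (+ 84) ≤ℤ (+ 0))
      × (d ≡ 7 → k ≤ 6)
      × (d ≡ 8 → k ≤ 12)
mainTheorem4 d k _ 2<k 2∣k S _ _ _ tetra≤d-7 =
  bounds-from-tetra d (even>2⇒≥4 2<k 2∣k) S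
    λ (quadruple α β γ δ α≢β α≢γ α≢δ β≢γ β≢δ γ≢δ) → tetra≤d-7 α β γ δ α≢β α≢γ α≢δ β≢γ β≢δ γ≢δ
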